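{- Let $k\in\mathbb{Z}$ and let $n \geq m \geq 1$ be integers. Then \begin{equation*} \begin{split} &\sum_{l=0}^{n-m}m!\binom{n}{l+m}S_{1}(l+m,m)C_{n-l-m}^{(k)}\\ &=\sum_{l=0}^{n-m}(m-1)!\binom{n-1}{l+m-1}S_{1}(l+m-1,m-1)\left\{(m-1)C_{n-l-m}^{(k)}(1)+C_{n-l-m}^{(k-1)}(1)\right\}. \end{split} \end{equation*}
   Context: For $k\in\mathbb{Z}$, $Lif_k(t)=\sum_{m=0}^{\infty}\frac{t^m}{m!(m+1)^k}$, and the poly-Cauchy polynomials $C_n^{(k)}(x)$ are defined by $\frac{Lif_k(\log(1+t))}{(1+t)^x}=\sum_{n=0}^\infty C_n^{(k)}(x)\frac{t^n}{n!}$; $C_n^{(k)}=C_n^{(k)}(0)$. The Stirling numbers of the first kind $S_1(l,m)$ are defined by $(\log(1+t))^m=m!\sum_{l\ge m}S_1(l,m)\frac{t^l}{l!}$ (so $S_1(0,0)=1$ and $S_1(l,0)=0$ for $l\ge1$). -}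

module Defs where

open import Data.Nat as ℕ using (ℕ; zero; suc; _∸_; _!)
open import Data.Nat.Combinatorics using (_C_)
open import Data.Integer as ℤ using (ℤ; +_; -[1+_])
open import Data.Rational using (ℚ; _/_; _+_; _*_; -_; 0ℚ; 1ℚ)

FPS : Set
FPS = ℕ → ℚ

⟦_⟧ : ℕ → ℚ
⟦ n ⟧ = + n / 1

sumTo : ℕ → (ℕ → ℚ) → ℚ
sumTo zero    f = f 0
sumTo (suc n) f = sumTo n f + f (suc n)

_^ℚ_ : ℚ → ℕ → ℚ
q ^ℚ zero  = 1ℚ
q ^ℚ suc j = q * (q ^ℚ j)

_⊛_ : FPS → FPS → FPS
(f ⊛ g) n = sumTo n (λ i → f i * g (n ∸ i))

_^ₛ_ : FPS → ℕ → FPS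
f ^ₛ zero  = λ { zero → 1ℚ ; (suc _) → 0ℚ }
f ^ₛ suc m = f ⊛ (f ^ₛ m)

log1p : FPS
log1p zero    = 0ℚ
log1p (suc n) = ((- 1ℚ) ^ℚ n) * (+ 1 / suc n)

invFact : ℕ → ℚ
invFact zero    = 1ℚ
invFact (suc m) = invFact m * (+ 1 / suc m)

-- (m+1)^(-k) for k : ℤ
invPowZ : ℕ → ℤ → ℚ
invPowZ m (+ j)      = (+ 1 / suc m) ^ℚ j
invPowZ m -[1+ j ]   = ⟦ suc m ⟧ ^ℚ suc j

-- coefficient of t^m in Lif_k(t) = Σ t^m / (m! (m+1)^k)
lifCoeff : ℤ → ℕ → ℚ
lifCoeff k m = invFact m * invPowZ m k

-- Lif_k(log(1+t)) as a formal power series.  Since log(1+t)^m has order m,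
-- the coefficient of t^n only receives contributions from m ≤ n.
lifLog : ℤ → FPS
lifLog k n = sumTo n (λ m → lifCoeff k m * (log1p ^ₛ m) n)

gbinom : ℚ → ℕ → ℚ
gbinom a zero    = 1ℚ
gbinom a (suc n) = gbinom a n * ((a + - ⟦ n ⟧) * (+ 1 / suc n))

onePlusTPow : ℚ → FPS
onePlusTPow a n = gbinom a n

-- poly-Cauchy polynomial C_n^{(k)}(x):
--   Lif_k(log(1+t)) / (1+t)^x = Σ_n C_n^{(k)}(x) t^n / n!
polyCauchy : ℕ → ℤ → ℚ → ℚ
polyCauchy n k x = ⟦ n ! ⟧ * (lifLog k ⊛ onePlusTPow (- x)) n

polyCauchy₀ : ℕ → ℤ → ℚ
polyCauchy₀ n k = polyCauchy n k 0ℚ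

-- Stirling numbers of the first kind (signed):
--   (log(1+t))^m = m! Σ_{l≥m} S₁(l,m) t^l / l!
S₁ : ℕ → ℕ → ℚ
S₁ l m = ⟦ l ! ⟧ * invFact m * (log1p ^ₛ m) l

-- Write L = log(1+t) and F_k = Lif_k(L). Since m! S₁(j,m)/j! = [tʲ] Lᵐ and C_r^{(k)} = r! [tʳ] F_k,
-- the left side is n! [tⁿ] Lᵐ F_k = (n-1)! [tⁿ⁻¹] (Lᵐ F_k)′; likewise, as C_r^{(k)}(1) = r! [tʳ] F_k/(1+t),
-- the right side is (n-1)! [tⁿ⁻¹] L^{m-1} ((m-1) F_k + F_{k-1})/(1+t). The two series agree: L′ = 1/(1+t)
-- gives (Lᵐ F_k)′ = L^{m-1} (m F_k/(1+t) + L F_k′), and (x Lif_k(x))′ = Lif_{k-1}(x) at x = L gives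
-- F_k/(1+t) + L F_k′ = F_{k-1}/(1+t).

module Submission where

open import Defs
open import Algebra.Bundles using (CommutativeMonoid)
import Algebra.Properties.CommutativeSemigroup as CommSemigroupProperties
open import Data.Nat using (ℕ; zero; suc; _≤_; _<_; z≤n; s≤s; _∸_; _!)
  renaming (_+_ to _+ℕ_; _*_ to _*ℕ_)
import Data.Nat.Properties as ℕP
open import Data.Nat.Combinatorics using (_C_; k![n∸k]!∣n!)
open import Data.Nat.Combinatorics.Specification using (nCk≡n!/k![n-k]!)
open import Data.Nat.DivMod using (m/n*n≡m)
import Data.Nat.Coprimality as Coprimality
open import Data.Sum using (inj₁; inj₂)
open import Data.Integer using (ℤ; _-_; -[1+_]) renaming (+_ to ι)
import Data.Integer as ℤ
import Data.Integer.Properties as ℤP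
open import Data.Rational using (ℚ; _+_; _*_; -_; 0ℚ; 1ℚ; mkℚ; _/_)
import Data.Rational.Properties as ℚP
open import Data.Rational.Solver using (module +-*-Solver)
open +-*-Solver using (solve; _:+_; _:*_; _:=_; con)
open import Relation.Binary.PropositionalEquality
  using (_≡_; refl; sym; trans; cong; cong₂; _≗_; _→-setoid_; module ≡-Reasoning)
import Relation.Binary.Reasoning.Setoid as SetoidReasoning

module +-Comm = CommSemigroupProperties (CommutativeMonoid.commutativeSemigroup ℚP.+-0-commutativeMonoid)
module *-Comm = CommSemigroupProperties (CommutativeMonoid.commutativeSemigroup ℚP.*-1-commutativeMonoid)

⟦⟧≡mkℚ : ∀ n → ⟦ n ⟧ ≡ mkℚ (ι n) 0 (Coprimality.sym (Coprimality.1-coprimeTo n))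
⟦⟧≡mkℚ n = ℚP.normalize-coprime (Coprimality.sym (Coprimality.1-coprimeTo n))

⟦suc⟧ : ∀ n → ⟦ suc n ⟧ ≡ 1ℚ + ⟦ n ⟧
⟦suc⟧ n = trans (ℚP./-cong {p₁ = ι (suc n)} (sym (cong (ℤ._+_ (ι 1)) (ℤP.*-identityʳ (ι n)))) refl)
                (cong (1ℚ +_) (sym (⟦⟧≡mkℚ n)))

⟦suc⟧*1/suc : ∀ n → ⟦ suc n ⟧ * (ι 1 / suc n) ≡ 1ℚ
⟦suc⟧*1/suc n = trans (cong₂ _*_ (⟦⟧≡mkℚ (suc n)) (ℚP.normalize-coprime (Coprimality.1-coprimeTo (suc n))))
                      (ℚP.*-inverseʳ (mkℚ (ι (suc n)) 0 (Coprimality.sym (Coprimality.1-coprimeTo (suc n)))))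

⟦+⟧ : ∀ a b → ⟦ a +ℕ b ⟧ ≡ ⟦ a ⟧ + ⟦ b ⟧
⟦+⟧ zero    b = sym (ℚP.+-identityˡ ⟦ b ⟧)
⟦+⟧ (suc a) b = begin
  ⟦ suc (a +ℕ b) ⟧      ≡⟨ ⟦suc⟧ (a +ℕ b) ⟩
  1ℚ + ⟦ a +ℕ b ⟧       ≡⟨ cong (1ℚ +_) (⟦+⟧ a b) ⟩
  1ℚ + (⟦ a ⟧ + ⟦ b ⟧)  ≡⟨ ℚP.+-assoc 1ℚ ⟦ a ⟧ ⟦ b ⟧ ⟨
  (1ℚ + ⟦ a ⟧) + ⟦ b ⟧  ≡⟨ cong (_+ ⟦ b ⟧) (⟦suc⟧ a) ⟨
  ⟦ suc a ⟧ + ⟦ b ⟧     ∎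
  where open ≡-Reasoning

⟦*⟧ : ∀ a b → ⟦ a *ℕ b ⟧ ≡ ⟦ a ⟧ * ⟦ b ⟧
⟦*⟧ zero    b = sym (ℚP.*-zeroˡ ⟦ b ⟧)
⟦*⟧ (suc a) b = begin
  ⟦ b +ℕ a *ℕ b ⟧        ≡⟨ ⟦+⟧ b (a *ℕ b) ⟩
  ⟦ b ⟧ + ⟦ a *ℕ b ⟧     ≡⟨ cong (⟦ b ⟧ +_) (⟦*⟧ a b) ⟩
  ⟦ b ⟧ + ⟦ a ⟧ * ⟦ b ⟧  ≡⟨ solve 2 (λ a b → b :+ a :* b := (con 1ℚ :+ a) :* b) refl ⟦ a ⟧ ⟦ b ⟧ ⟩
  (1ℚ + ⟦ a ⟧) * ⟦ b ⟧   ≡⟨ cong (_* ⟦ b ⟧) (⟦suc⟧ a) ⟨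
  ⟦ suc a ⟧ * ⟦ b ⟧      ∎
  where open ≡-Reasoning

⟦!⟧*invFact : ∀ m → ⟦ m ! ⟧ * invFact m ≡ 1ℚ
⟦!⟧*invFact zero    = refl
⟦!⟧*invFact (suc m) = begin
  ⟦ suc m *ℕ m ! ⟧ * (invFact m * (ι 1 / suc m))
    ≡⟨ cong (_* (invFact m * (ι 1 / suc m))) (⟦*⟧ (suc m) (m !)) ⟩
  ⟦ suc m ⟧ * ⟦ m ! ⟧ * (invFact m * (ι 1 / suc m))
    ≡⟨ solve 4 (λ s f i r → s :* f :* (i :* r) := (f :* i) :* (s :* r)) refl
               ⟦ suc m ⟧ ⟦ m ! ⟧ (invFact m) (ι 1 / suc m) ⟩
  (⟦ m ! ⟧ * invFact m) * (⟦ suc m ⟧ * (ι 1 / suc m))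
    ≡⟨ cong₂ _*_ (⟦!⟧*invFact m) (⟦suc⟧*1/suc m) ⟩
  1ℚ * 1ℚ
    ∎
  where open ≡-Reasoning

⟦C⟧*⟦!⟧*⟦!⟧ : ∀ {n k} → k ≤ n → ⟦ n C k ⟧ * ⟦ k ! ⟧ * ⟦ (n ∸ k) ! ⟧ ≡ ⟦ n ! ⟧
⟦C⟧*⟦!⟧*⟦!⟧ {n} {k} k≤n = begin
  ⟦ n C k ⟧ * ⟦ k ! ⟧ * ⟦ (n ∸ k) ! ⟧
    ≡⟨ cong (_* ⟦ (n ∸ k) ! ⟧) (⟦*⟧ (n C k) (k !)) ⟨
  ⟦ (n C k) *ℕ k ! ⟧ * ⟦ (n ∸ k) ! ⟧
    ≡⟨ ⟦*⟧ ((n C k) *ℕ k !) ((n ∸ k) !) ⟨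
  ⟦ (n C k) *ℕ k ! *ℕ (n ∸ k) ! ⟧
    ≡⟨ cong ⟦_⟧ (ℕP.*-assoc (n C k) (k !) ((n ∸ k) !)) ⟩
  ⟦ (n C k) *ℕ (k ! *ℕ (n ∸ k) !) ⟧
    ≡⟨ cong ⟦_⟧ (trans (cong (_*ℕ (k ! *ℕ (n ∸ k) !)) (nCk≡n!/k![n-k]! k≤n))
                       (m/n*n≡m {{ℕP._!*_!≢0 k (n ∸ k)}} (k![n∸k]!∣n! k≤n))) ⟩
  ⟦ n ! ⟧ ∎
  where open ≡-Reasoning

sumTo-cong-≤ : ∀ n {f g : ℕ → ℚ} → (∀ i → i ≤ n → f i ≡ g i) → sumTo n f ≡ sumTo n g
sumTo-cong-≤ zero    f≡g = f≡g 0 z≤n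
sumTo-cong-≤ (suc n) f≡g =
  cong₂ _+_ (sumTo-cong-≤ n (λ i i≤n → f≡g i (ℕP.m≤n⇒m≤1+n i≤n))) (f≡g (suc n) ℕP.≤-refl)

sumTo-cong : ∀ n {f g : ℕ → ℚ} → f ≗ g → sumTo n f ≡ sumTo n g
sumTo-cong n f≗g = sumTo-cong-≤ n (λ i _ → f≗g i)

sumTo-+ : ∀ n (f g : ℕ → ℚ) → sumTo n (λ i → f i + g i) ≡ sumTo n f + sumTo n g
sumTo-+ zero    f g = refl
sumTo-+ (suc n) f g = trans (cong (_+ (f (suc n) + g (suc n))) (sumTo-+ n f g))
                            (+-Comm.interchange (sumTo n f) (sumTo n g) (f (suc n)) (g (suc n)))

sumTo-*ˡ : ∀ n c (f : ℕ → ℚ) → sumTo n (λ i → c * f i) ≡ c * sumTo n f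
sumTo-*ˡ zero    c f = refl
sumTo-*ˡ (suc n) c f = trans (cong (_+ c * f (suc n)) (sumTo-*ˡ n c f))
                             (sym (ℚP.*-distribˡ-+ c (sumTo n f) (f (suc n))))

sumTo-*ʳ : ∀ n c (f : ℕ → ℚ) → sumTo n (λ i → f i * c) ≡ sumTo n f * c
sumTo-*ʳ zero    c f = refl
sumTo-*ʳ (suc n) c f = trans (cong (_+ f (suc n) * c) (sumTo-*ʳ n c f))
                             (sym (ℚP.*-distribʳ-+ c (sumTo n f) (f (suc n))))

sumTo-vanishes : ∀ n {f : ℕ → ℚ} → (∀ i → i ≤ n → f i ≡ 0ℚ) → sumTo n f ≡ 0ℚ
sumTo-vanishes zero    f≡0 = f≡0 0 z≤n
sumTo-vanishes (suc n) f≡0 =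
  trans (cong₂ _+_ (sumTo-vanishes n (λ i i≤n → f≡0 i (ℕP.m≤n⇒m≤1+n i≤n))) (f≡0 (suc n) ℕP.≤-refl))
        (ℚP.+-identityʳ 0ℚ)

sumTo-head : ∀ n (f : ℕ → ℚ) → sumTo (suc n) f ≡ f 0 + sumTo n (λ i → f (suc i))
sumTo-head zero    f = refl
sumTo-head (suc n) f = trans (cong (_+ f (suc (suc n))) (sumTo-head n f)) (ℚP.+-assoc (f 0) _ _)

sumTo-reverse : ∀ n (f : ℕ → ℚ) → sumTo n f ≡ sumTo n (λ i → f (n ∸ i))
sumTo-reverse zero    f = refl
sumTo-reverse (suc n) f = begin
  sumTo (suc n) f                         ≡⟨ sumTo-head n f ⟩
  f 0 + sumTo n (λ i → f (suc i))         ≡⟨ cong (f 0 +_) (sumTo-reverse n (λ i → f (suc i))) ⟩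
  f 0 + sumTo n (λ i → f (suc (n ∸ i)))   ≡⟨ ℚP.+-comm (f 0) _ ⟩
  sumTo n (λ i → f (suc (n ∸ i))) + f 0
    ≡⟨ cong₂ _+_ (sumTo-cong-≤ n (λ i i≤n → cong f (sym (ℕP.+-∸-assoc 1 i≤n))))
                 (cong f (sym (ℕP.n∸n≡0 n))) ⟩
  sumTo n (λ i → f (suc n ∸ i)) + f (suc n ∸ suc n) ∎
  where open ≡-Reasoning

sumTo-swap : ∀ n m (a : ℕ → ℕ → ℚ) →
  sumTo n (λ i → sumTo m (λ j → a i j)) ≡ sumTo m (λ j → sumTo n (λ i → a i j))
sumTo-swap zero    m a = refl
sumTo-swap (suc n) m a = trans (cong (_+ sumTo m (a (suc n))) (sumTo-swap n m a))
                               (sym (sumTo-+ m (λ j → sumTo n (λ i → a i j)) (a (suc n))))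

sumTo-extend : ∀ {n m} (f : ℕ → ℚ) → n ≤ m → (∀ i → n < i → f i ≡ 0ℚ) → sumTo m f ≡ sumTo n f
sumTo-extend {n} {zero}  f z≤n     _   = refl
sumTo-extend {n} {suc m} f n≤1+m f≡0 with ℕP.m≤n⇒m<n∨m≡n n≤1+m
... | inj₂ refl        = refl
... | inj₁ (s≤s n≤m) =
  trans (cong₂ _+_ (sumTo-extend f n≤m f≡0) (f≡0 (suc m) (s≤s n≤m))) (ℚP.+-identityʳ _)

sumTo-drop-prefix : ∀ {m n} (f : ℕ → ℚ) → m ≤ n → (∀ i → i < m → f i ≡ 0ℚ) →
  sumTo n f ≡ sumTo (n ∸ m) (λ l → f (l +ℕ m))
sumTo-drop-prefix {zero}  {n}     f _         _   = sumTo-cong n (λ l → cong f (sym (ℕP.+-identityʳ l)))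
sumTo-drop-prefix {suc m} {suc n} f (s≤s m≤n) f≡0 = begin
  sumTo (suc n) f                                   ≡⟨ sumTo-head n f ⟩
  f 0 + sumTo n (λ i → f (suc i))                   ≡⟨ cong (_+ sumTo n (λ i → f (suc i))) (f≡0 0 (s≤s z≤n)) ⟩
  0ℚ + sumTo n (λ i → f (suc i))                    ≡⟨ ℚP.+-identityˡ _ ⟩
  sumTo n (λ i → f (suc i))
    ≡⟨ sumTo-drop-prefix (λ i → f (suc i)) m≤n (λ i i<m → f≡0 (suc i) (s≤s i<m)) ⟩
  sumTo (n ∸ m) (λ l → f (suc (l +ℕ m)))            ≡⟨ sumTo-cong (n ∸ m) (λ l → cong f (sym (ℕP.+-suc l m))) ⟩
  sumTo (n ∸ m) (λ l → f (l +ℕ suc m))              ∎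
  where open ≡-Reasoning

sumTo-triangle : ∀ n (a : ℕ → ℕ → ℚ) →
  sumTo n (λ i → sumTo i (λ j → a j i)) ≡ sumTo n (λ j → sumTo (n ∸ j) (λ i → a j (j +ℕ i)))
sumTo-triangle zero    a = refl
sumTo-triangle (suc n) a = begin
  sumTo n (λ i → sumTo i (λ j → a j i)) + sumTo (suc n) (λ j → a j (suc n))
    ≡⟨ cong (_+ sumTo (suc n) (λ j → a j (suc n))) (sumTo-triangle n a) ⟩
  rows + (sumTo n (λ j → a j (suc n)) + a (suc n) (suc n))
    ≡⟨ ℚP.+-assoc rows _ _ ⟨
  (rows + sumTo n (λ j → a j (suc n))) + a (suc n) (suc n)
    ≡⟨ cong₂ _+_ (sym (sumTo-+ n (λ j → sumTo (n ∸ j) (λ i → a j (j +ℕ i))) (λ j → a j (suc n))))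
                 last-row ⟩
  sumTo n (λ j → sumTo (n ∸ j) (λ i → a j (j +ℕ i)) + a j (suc n))
      + sumTo (n ∸ n) (λ i → a (suc n) (suc n +ℕ i))
    ≡⟨ cong (_+ sumTo (n ∸ n) (λ i → a (suc n) (suc n +ℕ i))) (sumTo-cong-≤ n extend-row) ⟩
  sumTo n (λ j → sumTo (suc n ∸ j) (λ i → a j (j +ℕ i)))
      + sumTo (n ∸ n) (λ i → a (suc n) (suc n +ℕ i)) ∎
  where
  open ≡-Reasoning
  rows : ℚ
  rows = sumTo n (λ j → sumTo (n ∸ j) (λ i → a j (j +ℕ i)))
  extend-row : ∀ j → j ≤ n → sumTo (n ∸ j) (λ i → a j (j +ℕ i)) + a j (suc n)
                           ≡ sumTo (suc n ∸ j) (λ i → a j (j +ℕ i))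
  extend-row j j≤n = trans
    (cong (λ x → sumTo (n ∸ j) (λ i → a j (j +ℕ i)) + a j x)
          (sym (trans (ℕP.+-suc j (n ∸ j)) (cong suc (ℕP.m+[n∸m]≡n j≤n)))))
    (cong (λ x → sumTo x (λ i → a j (j +ℕ i))) (sym (ℕP.+-∸-assoc 1 j≤n)))
  last-row : a (suc n) (suc n) ≡ sumTo (n ∸ n) (λ i → a (suc n) (suc n +ℕ i))
  last-row = trans (cong (a (suc n)) (sym (ℕP.+-identityʳ (suc n))))
                   (cong (λ x → sumTo x (λ i → a (suc n) (suc n +ℕ i))) (sym (ℕP.n∸n≡0 n)))

0ₛ : FPS
0ₛ _ = 0ℚ

1ₛ : FPS
1ₛ zero    = 1ℚ
1ₛ (suc _) = 0ℚ

infixl 6 _⊕_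
infixr 7 _·_

_⊕_ : FPS → FPS → FPS
(f ⊕ g) n = f n + g n

_·_ : ℚ → FPS → FPS
(c · f) n = c * f n

D : FPS → FPS
D f n = ⟦ suc n ⟧ * f (suc n)

module ≗-Reasoning = SetoidReasoning (ℕ →-setoid ℚ)

⊕-cong : ∀ {f f′ g g′ : FPS} → f ≗ f′ → g ≗ g′ → f ⊕ g ≗ f′ ⊕ g′
⊕-cong f≗f′ g≗g′ n = cong₂ _+_ (f≗f′ n) (g≗g′ n)

⊕-congˡ : ∀ {f f′} (g : FPS) → f ≗ f′ → f ⊕ g ≗ f′ ⊕ g
⊕-congˡ g f≗f′ n = cong (_+ g n) (f≗f′ n)

⊕-congʳ : ∀ (f : FPS) {g g′} → g ≗ g′ → f ⊕ g ≗ f ⊕ g′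
⊕-congʳ f g≗g′ n = cong (f n +_) (g≗g′ n)

·-congʳ : ∀ c {f g : FPS} → f ≗ g → c · f ≗ c · g
·-congʳ c f≗g n = cong (c *_) (f≗g n)

⊛-cong : ∀ {f f′ g g′ : FPS} → f ≗ f′ → g ≗ g′ → f ⊛ g ≗ f′ ⊛ g′
⊛-cong f≗f′ g≗g′ n = sumTo-cong n (λ i → cong₂ _*_ (f≗f′ i) (g≗g′ (n ∸ i)))

⊛-congˡ : ∀ {f f′} (g : FPS) → f ≗ f′ → f ⊛ g ≗ f′ ⊛ g
⊛-congˡ g f≗f′ = ⊛-cong {g = g} f≗f′ (λ _ → refl)

⊛-congʳ : ∀ (f : FPS) {g g′} → g ≗ g′ → f ⊛ g ≗ f ⊛ g′
⊛-congʳ f = ⊛-cong {f = f} (λ _ → refl)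

⊛-comm : ∀ f g → f ⊛ g ≗ g ⊛ f
⊛-comm f g n = trans (sumTo-reverse n (λ i → f i * g (n ∸ i)))
  (sumTo-cong-≤ n (λ i i≤n → trans (cong (λ j → f (n ∸ i) * g j) (ℕP.m∸[m∸n]≡n i≤n))
                                    (ℚP.*-comm (f (n ∸ i)) (g i))))

⊛-assoc : ∀ f g h → (f ⊛ g) ⊛ h ≗ f ⊛ (g ⊛ h)
⊛-assoc f g h n = begin
  sumTo n (λ i → sumTo i (λ j → f j * g (i ∸ j)) * h (n ∸ i))
    ≡⟨ sumTo-cong n (λ i → sym (sumTo-*ʳ i (h (n ∸ i)) (λ j → f j * g (i ∸ j)))) ⟩
  sumTo n (λ i → sumTo i (λ j → f j * g (i ∸ j) * h (n ∸ i)))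
    ≡⟨ sumTo-triangle n (λ j i → f j * g (i ∸ j) * h (n ∸ i)) ⟩
  sumTo n (λ j → sumTo (n ∸ j) (λ i → f j * g (j +ℕ i ∸ j) * h (n ∸ (j +ℕ i))))
    ≡⟨ sumTo-cong n (λ j → trans (sumTo-cong (n ∸ j) (reindex j))
                                 (sumTo-*ˡ (n ∸ j) (f j) (λ i → g i * h (n ∸ j ∸ i)))) ⟩
  sumTo n (λ j → f j * sumTo (n ∸ j) (λ i → g i * h (n ∸ j ∸ i))) ∎
  where
  open ≡-Reasoning
  reindex : ∀ j i → f j * g (j +ℕ i ∸ j) * h (n ∸ (j +ℕ i)) ≡ f j * (g i * h (n ∸ j ∸ i))
  reindex j i = trans (cong₂ (λ x y → f j * g x * h y) (ℕP.m+n∸m≡n j i) (sym (ℕP.∸-+-assoc n j i)))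
                      (ℚP.*-assoc (f j) (g i) (h (n ∸ j ∸ i)))

⊛-distribˡ : ∀ f g h → f ⊛ (g ⊕ h) ≗ (f ⊛ g) ⊕ (f ⊛ h)
⊛-distribˡ f g h n = trans (sumTo-cong n (λ i → ℚP.*-distribˡ-+ (f i) (g (n ∸ i)) (h (n ∸ i))))
                           (sumTo-+ n (λ i → f i * g (n ∸ i)) (λ i → f i * h (n ∸ i)))

·-⊛ : ∀ c f g → (c · f) ⊛ g ≗ c · (f ⊛ g)
·-⊛ c f g n = trans (sumTo-cong n (λ i → ℚP.*-assoc c (f i) (g (n ∸ i))))
                    (sumTo-*ˡ n c (λ i → f i * g (n ∸ i)))

⊛-· : ∀ c f g → f ⊛ (c · g) ≗ c · (f ⊛ g)
⊛-· c f g n = trans (sumTo-cong n (λ i → *-Comm.x∙yz≈y∙xz (f i) c (g (n ∸ i))))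
                    (sumTo-*ˡ n c (λ i → f i * g (n ∸ i)))

⊛-identityˡ : ∀ f → 1ₛ ⊛ f ≗ f
⊛-identityˡ f zero    = ℚP.*-identityˡ (f 0)
⊛-identityˡ f (suc n) = begin
  sumTo (suc n) (λ i → 1ₛ i * f (suc n ∸ i))
    ≡⟨ sumTo-head n (λ i → 1ₛ i * f (suc n ∸ i)) ⟩
  1ℚ * f (suc n) + sumTo n (λ i → 0ℚ * f (n ∸ i))
    ≡⟨ cong₂ _+_ (ℚP.*-identityˡ (f (suc n))) (sumTo-vanishes n (λ i _ → ℚP.*-zeroˡ (f (n ∸ i)))) ⟩
  f (suc n) + 0ℚ
    ≡⟨ ℚP.+-identityʳ (f (suc n)) ⟩
  f (suc n) ∎
  where open ≡-Reasoning

⊛-identityʳ : ∀ f → f ⊛ 1ₛ ≗ f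
⊛-identityʳ f n = trans (⊛-comm f 1ₛ n) (⊛-identityˡ f n)

⊛-zeroʳ : ∀ f → f ⊛ 0ₛ ≗ 0ₛ
⊛-zeroʳ f n = sumTo-vanishes n (λ i _ → ℚP.*-zeroʳ (f i))

^ₛ-vanishes : ∀ f → f 0 ≡ 0ℚ → ∀ j n → n < j → (f ^ₛ j) n ≡ 0ℚ
^ₛ-vanishes f f₀≡0 (suc j) n (s≤s n≤j) = sumTo-vanishes n term
  where
  term : ∀ i → i ≤ n → f i * (f ^ₛ j) (n ∸ i) ≡ 0ℚ
  term zero    _       = trans (cong (_* (f ^ₛ j) n) f₀≡0) (ℚP.*-zeroˡ ((f ^ₛ j) n))
  term (suc i) 1+i≤n = trans
    (cong (f (suc i) *_) (^ₛ-vanishes f f₀≡0 j (n ∸ suc i)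
      (ℕP.<-≤-trans (ℕP.∸-monoʳ-< {n} {suc i} {0} (s≤s z≤n) 1+i≤n) n≤j)))
    (ℚP.*-zeroʳ (f (suc i)))

D-⊛ : ∀ f g → D (f ⊛ g) ≗ (D f ⊛ g) ⊕ (f ⊛ D g)
D-⊛ f g n = begin
  ⟦ suc n ⟧ * sumTo (suc n) (λ i → f i * g (suc n ∸ i))
    ≡⟨ sumTo-*ˡ (suc n) ⟦ suc n ⟧ (λ i → f i * g (suc n ∸ i)) ⟨
  sumTo (suc n) (λ i → ⟦ suc n ⟧ * (f i * g (suc n ∸ i)))
    ≡⟨ sumTo-cong-≤ (suc n) split-weight ⟩
  sumTo (suc n) (λ i → ⟦ i ⟧ * f i * g (suc n ∸ i) + f i * (⟦ suc n ∸ i ⟧ * g (suc n ∸ i)))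
    ≡⟨ sumTo-+ (suc n) (λ i → ⟦ i ⟧ * f i * g (suc n ∸ i)) (λ i → f i * (⟦ suc n ∸ i ⟧ * g (suc n ∸ i))) ⟩
  sumTo (suc n) (λ i → ⟦ i ⟧ * f i * g (suc n ∸ i))
    + sumTo (suc n) (λ i → f i * (⟦ suc n ∸ i ⟧ * g (suc n ∸ i)))
    ≡⟨ cong₂ _+_ left right ⟩
  (D f ⊛ g) n + (f ⊛ D g) n ∎
  where
  open ≡-Reasoning
  split-weight : ∀ i → i ≤ suc n →
    ⟦ suc n ⟧ * (f i * g (suc n ∸ i)) ≡ ⟦ i ⟧ * f i * g (suc n ∸ i) + f i * (⟦ suc n ∸ i ⟧ * g (suc n ∸ i))
  split-weight i i≤1+n = trans
    (cong (_* (f i * g (suc n ∸ i))) (trans (cong ⟦_⟧ (sym (ℕP.m+[n∸m]≡n i≤1+n))) (⟦+⟧ i (suc n ∸ i))))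
    (solve 4 (λ a b x y → (a :+ b) :* (x :* y) := a :* x :* y :+ x :* (b :* y)) refl
             ⟦ i ⟧ ⟦ suc n ∸ i ⟧ (f i) (g (suc n ∸ i)))
  left : sumTo (suc n) (λ i → ⟦ i ⟧ * f i * g (suc n ∸ i)) ≡ (D f ⊛ g) n
  left = trans (sumTo-head n (λ i → ⟦ i ⟧ * f i * g (suc n ∸ i)))
    (trans (cong (_+ (D f ⊛ g) n) (trans (cong (_* g (suc n)) (ℚP.*-zeroˡ (f 0))) (ℚP.*-zeroˡ (g (suc n)))))
           (ℚP.+-identityˡ ((D f ⊛ g) n)))
  right : sumTo (suc n) (λ i → f i * (⟦ suc n ∸ i ⟧ * g (suc n ∸ i))) ≡ (f ⊛ D g) n
  right = trans
    (cong₂ _+_ (sumTo-cong-≤ n (λ i i≤n → cong (λ x → f i * (⟦ x ⟧ * g x)) (ℕP.+-∸-assoc 1 i≤n)))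
               (trans (cong (λ x → f (suc n) * (⟦ x ⟧ * g (suc n ∸ suc n))) (ℕP.n∸n≡0 n))
                      (trans (cong (f (suc n) *_) (ℚP.*-zeroˡ (g (suc n ∸ suc n)))) (ℚP.*-zeroʳ (f (suc n))))))
    (ℚP.+-identityʳ ((f ⊛ D g) n))

D-^ₛ : ∀ f p → D (f ^ₛ suc p) ≗ ⟦ suc p ⟧ · ((f ^ₛ p) ⊛ D f)
D-^ₛ f zero = begin
  D (f ⊛ (f ^ₛ 0))                            ≈⟨ D-⊛ f (f ^ₛ 0) ⟩
  (D f ⊛ (f ^ₛ 0)) ⊕ (f ⊛ D (f ^ₛ 0))         ≈⟨ ⊕-cong (⊛-comm (D f) (f ^ₛ 0)) (⊛-congʳ f D-^ₛ0) ⟩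
  ((f ^ₛ 0) ⊛ D f) ⊕ (f ⊛ 0ₛ)                 ≈⟨ ⊕-congʳ ((f ^ₛ 0) ⊛ D f) (⊛-zeroʳ f) ⟩
  ((f ^ₛ 0) ⊛ D f) ⊕ 0ₛ                       ≈⟨ (λ n → trans (ℚP.+-identityʳ (((f ^ₛ 0) ⊛ D f) n)) (sym (ℚP.*-identityˡ (((f ^ₛ 0) ⊛ D f) n)))) ⟩
  1ℚ · ((f ^ₛ 0) ⊛ D f)                       ∎
  where
  open ≗-Reasoning
  D-^ₛ0 : D (f ^ₛ 0) ≗ 0ₛ
  D-^ₛ0 n = ℚP.*-zeroʳ ⟦ suc n ⟧
D-^ₛ f (suc p) = begin
  D (f ⊛ (f ^ₛ suc p))                                  ≈⟨ D-⊛ f (f ^ₛ suc p) ⟩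
  (D f ⊛ (f ^ₛ suc p)) ⊕ (f ⊛ D (f ^ₛ suc p))           ≈⟨ ⊕-cong (⊛-comm (D f) (f ^ₛ suc p)) (⊛-congʳ f (D-^ₛ f p)) ⟩
  ((f ^ₛ suc p) ⊛ D f) ⊕ (f ⊛ (⟦ suc p ⟧ · ((f ^ₛ p) ⊛ D f)))
    ≈⟨ ⊕-congʳ ((f ^ₛ suc p) ⊛ D f) (λ n → trans (⊛-· ⟦ suc p ⟧ f ((f ^ₛ p) ⊛ D f) n)
                                         (cong (⟦ suc p ⟧ *_) (sym (⊛-assoc f (f ^ₛ p) (D f) n)))) ⟩
  ((f ^ₛ suc p) ⊛ D f) ⊕ (⟦ suc p ⟧ · ((f ^ₛ suc p) ⊛ D f))
    ≈⟨ (λ n → trans (solve 2 (λ x s → x :+ s :* x := (con 1ℚ :+ s) :* x) refl (((f ^ₛ suc p) ⊛ D f) n) ⟦ suc p ⟧)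
                    (cong (_* ((f ^ₛ suc p) ⊛ D f) n) (sym (⟦suc⟧ (suc p))))) ⟩
  ⟦ suc (suc p) ⟧ · ((f ^ₛ suc p) ⊛ D f) ∎
  where open ≗-Reasoning

-- Composition a(g(t)); the truncation at j ≤ n is exact as soon as g 0 = 0.
_∘ₛ_ : FPS → FPS → FPS
(a ∘ₛ g) n = sumTo n (λ j → a j * (g ^ₛ j) n)

∘ₛ-congˡ : ∀ {a b} (g : FPS) → a ≗ b → a ∘ₛ g ≗ b ∘ₛ g
∘ₛ-congˡ g a≗b n = sumTo-cong n (λ j → cong (_* (g ^ₛ j) n) (a≗b j))

⊛-∘ₛ : ∀ f a g → g 0 ≡ 0ℚ → f ⊛ (a ∘ₛ g) ≗ λ n → sumTo n (λ j → a j * (f ⊛ (g ^ₛ j)) n)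
⊛-∘ₛ f a g g₀≡0 n = begin
  sumTo n (λ i → f i * sumTo (n ∸ i) (λ j → a j * (g ^ₛ j) (n ∸ i)))
    ≡⟨ sumTo-cong n (λ i → cong (f i *_) (sym (sumTo-extend (λ j → a j * (g ^ₛ j) (n ∸ i))
                                                          (ℕP.m∸n≤m n i) (high-powers-vanish i)))) ⟩
  sumTo n (λ i → f i * sumTo n (λ j → a j * (g ^ₛ j) (n ∸ i)))
    ≡⟨ sumTo-cong n (λ i → sym (sumTo-*ˡ n (f i) (λ j → a j * (g ^ₛ j) (n ∸ i)))) ⟩
  sumTo n (λ i → sumTo n (λ j → f i * (a j * (g ^ₛ j) (n ∸ i))))
    ≡⟨ sumTo-swap n n (λ i j → f i * (a j * (g ^ₛ j) (n ∸ i))) ⟩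
  sumTo n (λ j → sumTo n (λ i → f i * (a j * (g ^ₛ j) (n ∸ i))))
    ≡⟨ sumTo-cong n (λ j → trans (sumTo-cong n (λ i → *-Comm.x∙yz≈y∙xz (f i) (a j) ((g ^ₛ j) (n ∸ i))))
                                 (sumTo-*ˡ n (a j) (λ i → f i * (g ^ₛ j) (n ∸ i)))) ⟩
  sumTo n (λ j → a j * sumTo n (λ i → f i * (g ^ₛ j) (n ∸ i))) ∎
  where
  open ≡-Reasoning
  high-powers-vanish : ∀ i j → n ∸ i < j → a j * (g ^ₛ j) (n ∸ i) ≡ 0ℚ
  high-powers-vanish i j n∸i<j = trans (cong (a j *_) (^ₛ-vanishes g g₀≡0 j (n ∸ i) n∸i<j)) (ℚP.*-zeroʳ (a j))

-- The chain rule applied to (x a(x))′ = Σ (j+1) a_j xʲ at x = g.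
D-⊛-∘ₛ : ∀ a g → g 0 ≡ 0ℚ → D (g ⊛ (a ∘ₛ g)) ≗ ((λ j → ⟦ suc j ⟧ * a j) ∘ₛ g) ⊛ D g
D-⊛-∘ₛ a g g₀≡0 n = begin
  ⟦ suc n ⟧ * (g ⊛ (a ∘ₛ g)) (suc n)
    ≡⟨ cong (⟦ suc n ⟧ *_) (⊛-∘ₛ g a g g₀≡0 (suc n)) ⟩
  ⟦ suc n ⟧ * sumTo (suc n) (λ j → a j * (g ^ₛ suc j) (suc n))
    ≡⟨ cong (⟦ suc n ⟧ *_) (sumTo-extend (λ j → a j * (g ^ₛ suc j) (suc n)) (ℕP.n≤1+n n) top-vanishes) ⟩
  ⟦ suc n ⟧ * sumTo n (λ j → a j * (g ^ₛ suc j) (suc n))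
    ≡⟨ sumTo-*ˡ n ⟦ suc n ⟧ (λ j → a j * (g ^ₛ suc j) (suc n)) ⟨
  sumTo n (λ j → ⟦ suc n ⟧ * (a j * (g ^ₛ suc j) (suc n)))
    ≡⟨ sumTo-cong n (λ j → trans (*-Comm.x∙yz≈y∙xz ⟦ suc n ⟧ (a j) ((g ^ₛ suc j) (suc n)))
                                 (cong (a j *_) (D-^ₛ g j n))) ⟩
  sumTo n (λ j → a j * (⟦ suc j ⟧ * ((g ^ₛ j) ⊛ D g) n))
    ≡⟨ sumTo-cong n (λ j → trans (*-Comm.x∙yz≈yx∙z (a j) ⟦ suc j ⟧ (((g ^ₛ j) ⊛ D g) n))
                                 (cong (b j *_) (⊛-comm (g ^ₛ j) (D g) n))) ⟩
  sumTo n (λ j → b j * (D g ⊛ (g ^ₛ j)) n)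
    ≡⟨ ⊛-∘ₛ (D g) b g g₀≡0 n ⟨
  (D g ⊛ (b ∘ₛ g)) n
    ≡⟨ ⊛-comm (D g) (b ∘ₛ g) n ⟩
  ((b ∘ₛ g) ⊛ D g) n ∎
  where
  open ≡-Reasoning
  b : ℕ → ℚ
  b j = ⟦ suc j ⟧ * a j
  top-vanishes : ∀ j → n < j → a j * (g ^ₛ suc j) (suc n) ≡ 0ℚ
  top-vanishes j n<j = trans (cong (a j *_) (^ₛ-vanishes g g₀≡0 (suc j) (suc n) (s≤s n<j))) (ℚP.*-zeroʳ (a j))

1/[1+t] : FPS
1/[1+t] = onePlusTPow (- 1ℚ)

onePlusTPow-0 : onePlusTPow (- 0ℚ) ≗ 1ₛ
onePlusTPow-0 zero          = refl
onePlusTPow-0 (suc zero)    = refl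
onePlusTPow-0 (suc (suc n)) =
  trans (cong (_* ((- 0ℚ + - ⟦ suc n ⟧) * (ι 1 / suc (suc n)))) (onePlusTPow-0 (suc n)))
        (ℚP.*-zeroˡ ((- 0ℚ + - ⟦ suc n ⟧) * (ι 1 / suc (suc n))))

gbinom-−1 : ∀ n → gbinom (- 1ℚ) n ≡ (- 1ℚ) ^ℚ n
gbinom-−1 zero    = refl
gbinom-−1 (suc n) = begin
  gbinom (- 1ℚ) n * ((- 1ℚ + - ⟦ n ⟧) * (ι 1 / suc n))
    ≡⟨ cong₂ _*_ (gbinom-−1 n) (sym (trans (ℚP.neg-distribˡ-* (1ℚ + ⟦ n ⟧) (ι 1 / suc n))
                                           (cong (_* (ι 1 / suc n)) (ℚP.neg-distrib-+ 1ℚ ⟦ n ⟧)))) ⟩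
  ((- 1ℚ) ^ℚ n) * (- ((1ℚ + ⟦ n ⟧) * (ι 1 / suc n)))
    ≡⟨ cong (λ x → ((- 1ℚ) ^ℚ n) * (- (x * (ι 1 / suc n)))) (⟦suc⟧ n) ⟨
  ((- 1ℚ) ^ℚ n) * (- (⟦ suc n ⟧ * (ι 1 / suc n)))
    ≡⟨ cong (λ x → ((- 1ℚ) ^ℚ n) * (- x)) (⟦suc⟧*1/suc n) ⟩
  ((- 1ℚ) ^ℚ n) * (- 1ℚ)
    ≡⟨ ℚP.*-comm ((- 1ℚ) ^ℚ n) (- 1ℚ) ⟩
  (- 1ℚ) * ((- 1ℚ) ^ℚ n) ∎
  where open ≡-Reasoning

D-log1p : D log1p ≗ 1/[1+t]
D-log1p n = begin
  ⟦ suc n ⟧ * (((- 1ℚ) ^ℚ n) * (ι 1 / suc n))  ≡⟨ *-Comm.x∙yz≈y∙xz ⟦ suc n ⟧ ((- 1ℚ) ^ℚ n) (ι 1 / suc n) ⟩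
  ((- 1ℚ) ^ℚ n) * (⟦ suc n ⟧ * (ι 1 / suc n))  ≡⟨ cong (((- 1ℚ) ^ℚ n) *_) (⟦suc⟧*1/suc n) ⟩
  ((- 1ℚ) ^ℚ n) * 1ℚ                           ≡⟨ ℚP.*-identityʳ _ ⟩
  (- 1ℚ) ^ℚ n                                  ≡⟨ gbinom-−1 n ⟨
  1/[1+t] n                                    ∎
  where open ≡-Reasoning

invPowZ-pred : ∀ j k → ⟦ suc j ⟧ * invPowZ j k ≡ invPowZ j (k - ι 1)
invPowZ-pred j (ι zero)    = refl
invPowZ-pred j (ι (suc i)) = begin
  ⟦ suc j ⟧ * ((ι 1 / suc j) * invPowZ j (ι i))  ≡⟨ ℚP.*-assoc ⟦ suc j ⟧ (ι 1 / suc j) (invPowZ j (ι i)) ⟨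
  (⟦ suc j ⟧ * (ι 1 / suc j)) * invPowZ j (ι i)  ≡⟨ cong (_* invPowZ j (ι i)) (⟦suc⟧*1/suc j) ⟩
  1ℚ * invPowZ j (ι i)                           ≡⟨ ℚP.*-identityˡ (invPowZ j (ι i)) ⟩
  invPowZ j (ι i)                                ∎
  where open ≡-Reasoning
invPowZ-pred j -[1+ i ]    = cong (λ e → invPowZ j -[1+ suc e ]) (sym (ℕP.+-identityʳ i))

lifCoeff-pred : ∀ k j → ⟦ suc j ⟧ * lifCoeff k j ≡ lifCoeff (k - ι 1) j
lifCoeff-pred k j = trans (*-Comm.x∙yz≈y∙xz ⟦ suc j ⟧ (invFact j) (invPowZ j k))
                          (cong (invFact j *_) (invPowZ-pred j k))

D-log1p⊛lifLog : ∀ k → D (log1p ⊛ lifLog k) ≗ lifLog (k - ι 1) ⊛ 1/[1+t]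
D-log1p⊛lifLog k = begin
  D (log1p ⊛ lifLog k)                                    ≈⟨ D-⊛-∘ₛ (lifCoeff k) log1p refl ⟩
  ((λ j → ⟦ suc j ⟧ * lifCoeff k j) ∘ₛ log1p) ⊛ D log1p
    ≈⟨ ⊛-cong (∘ₛ-congˡ log1p (lifCoeff-pred k)) D-log1p ⟩
  lifLog (k - ι 1) ⊛ 1/[1+t]                              ∎
  where open ≗-Reasoning

lifLog-ode : ∀ k → lifLog k ⊛ 1/[1+t] ⊕ log1p ⊛ D (lifLog k) ≗ lifLog (k - ι 1) ⊛ 1/[1+t]
lifLog-ode k = begin
  lifLog k ⊛ 1/[1+t] ⊕ log1p ⊛ D (lifLog k)
    ≈⟨ ⊕-congˡ (log1p ⊛ D (lifLog k))
               (λ n → trans (⊛-comm (lifLog k) 1/[1+t] n) (sym (⊛-congˡ (lifLog k) D-log1p n))) ⟩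
  D log1p ⊛ lifLog k ⊕ log1p ⊛ D (lifLog k)               ≈⟨ D-⊛ log1p (lifLog k) ⟨
  D (log1p ⊛ lifLog k)                                    ≈⟨ D-log1p⊛lifLog k ⟩
  lifLog (k - ι 1) ⊛ 1/[1+t]                              ∎
  where open ≗-Reasoning

D-log1p^⊛lifLog : ∀ k p →
  D ((log1p ^ₛ suc p) ⊛ lifLog k)
    ≗ (log1p ^ₛ p) ⊛ (⟦ p ⟧ · (lifLog k ⊛ 1/[1+t]) ⊕ lifLog (k - ι 1) ⊛ 1/[1+t])
D-log1p^⊛lifLog k p = begin
  D (Lᵖ⁺¹ ⊛ F)                                   ≈⟨ D-⊛ Lᵖ⁺¹ F ⟩
  D Lᵖ⁺¹ ⊛ F ⊕ Lᵖ⁺¹ ⊛ D F                        ≈⟨ ⊕-cong first second ⟩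
  Lᵖ ⊛ (s · (F ⊛ 1/[1+t])) ⊕ Lᵖ ⊛ (log1p ⊛ D F)  ≈⟨ ⊛-distribˡ Lᵖ (s · (F ⊛ 1/[1+t])) (log1p ⊛ D F) ⟨
  Lᵖ ⊛ (s · (F ⊛ 1/[1+t]) ⊕ log1p ⊛ D F)         ≈⟨ ⊛-congʳ Lᵖ regroup ⟩
  Lᵖ ⊛ (⟦ p ⟧ · (F ⊛ 1/[1+t]) ⊕ lifLog (k - ι 1) ⊛ 1/[1+t]) ∎
  where
  open ≗-Reasoning
  F Lᵖ Lᵖ⁺¹ : FPS
  F    = lifLog k
  Lᵖ   = log1p ^ₛ p
  Lᵖ⁺¹ = log1p ^ₛ suc p
  s : ℚ
  s = ⟦ suc p ⟧
  first : D Lᵖ⁺¹ ⊛ F ≗ Lᵖ ⊛ (s · (F ⊛ 1/[1+t]))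
  first = begin
    D Lᵖ⁺¹ ⊛ F                   ≈⟨ ⊛-congˡ F (D-^ₛ log1p p) ⟩
    (s · (Lᵖ ⊛ D log1p)) ⊛ F     ≈⟨ ·-⊛ s (Lᵖ ⊛ D log1p) F ⟩
    s · ((Lᵖ ⊛ D log1p) ⊛ F)     ≈⟨ ·-congʳ s (⊛-assoc Lᵖ (D log1p) F) ⟩
    s · (Lᵖ ⊛ (D log1p ⊛ F))     ≈⟨ ⊛-· s Lᵖ (D log1p ⊛ F) ⟨
    Lᵖ ⊛ (s · (D log1p ⊛ F))
      ≈⟨ ⊛-congʳ Lᵖ (·-congʳ s (λ n → trans (⊛-congˡ F D-log1p n) (⊛-comm 1/[1+t] F n))) ⟩
    Lᵖ ⊛ (s · (F ⊛ 1/[1+t]))     ∎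
  second : Lᵖ⁺¹ ⊛ D F ≗ Lᵖ ⊛ (log1p ⊛ D F)
  second = begin
    (log1p ⊛ Lᵖ) ⊛ D F   ≈⟨ ⊛-congˡ (D F) (⊛-comm log1p Lᵖ) ⟩
    (Lᵖ ⊛ log1p) ⊛ D F   ≈⟨ ⊛-assoc Lᵖ log1p (D F) ⟩
    Lᵖ ⊛ (log1p ⊛ D F)   ∎
  regroup : s · (F ⊛ 1/[1+t]) ⊕ log1p ⊛ D F ≗ ⟦ p ⟧ · (F ⊛ 1/[1+t]) ⊕ lifLog (k - ι 1) ⊛ 1/[1+t]
  regroup n = trans (cong (λ c → c * x + y) (⟦suc⟧ p))
    (trans (solve 3 (λ q x y → (con 1ℚ :+ q) :* x :+ y := q :* x :+ (x :+ y)) refl ⟦ p ⟧ x y)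
           (cong (⟦ p ⟧ * x +_) (lifLog-ode k n)))
    where
    x y : ℚ
    x = (F ⊛ 1/[1+t]) n
    y = (log1p ⊛ D F) n

suc-∸-∸-suc : ∀ n l p → suc n ∸ l ∸ suc p ≡ n ∸ l ∸ p
suc-∸-∸-suc n l p = trans (ℕP.∸-+-assoc (suc n) l (suc p))
                          (trans (cong (suc n ∸_) (ℕP.+-suc l p)) (sym (ℕP.∸-+-assoc n l p)))

polyCauchy₁-combination : ∀ k p r →
  ⟦ r ! ⟧ * (⟦ p ⟧ · (lifLog k ⊛ 1/[1+t]) ⊕ lifLog (k - ι 1) ⊛ 1/[1+t]) r
    ≡ ⟦ p ⟧ * polyCauchy r k 1ℚ + polyCauchy r (k - ι 1) 1ℚ
polyCauchy₁-combination k p r =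
  solve 4 (λ c q a b → c :* (q :* a :+ b) := q :* (c :* a) :+ c :* b) refl
        ⟦ r ! ⟧ ⟦ p ⟧ ((lifLog k ⊛ 1/[1+t]) r) ((lifLog (k - ι 1) ⊛ 1/[1+t]) r)

⟦suc!⟧*≡⟦!⟧*D : ∀ n (f : FPS) → ⟦ suc n ! ⟧ * f (suc n) ≡ ⟦ n ! ⟧ * D f n
⟦suc!⟧*≡⟦!⟧*D n f = trans (cong (_* f (suc n)) (⟦*⟧ (suc n) (n !)))
                            (*-Comm.xy∙z≈y∙xz ⟦ suc n ⟧ ⟦ n ! ⟧ (f (suc n)))

polyCauchy₀≡⟦!⟧*lifLog : ∀ r k → polyCauchy₀ r k ≡ ⟦ r ! ⟧ * lifLog k r
polyCauchy₀≡⟦!⟧*lifLog r k = cong (⟦ r ! ⟧ *_)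
  (trans (⊛-congʳ (lifLog k) onePlusTPow-0 r) (⊛-identityʳ (lifLog k) r))

S₁-convolution : ∀ {m n} (Y : FPS) → m ≤ n →
  sumTo (n ∸ m) (λ l → ⟦ m ! ⟧ * ⟦ n C (l +ℕ m) ⟧ * S₁ (l +ℕ m) m * (⟦ (n ∸ l ∸ m) ! ⟧ * Y (n ∸ l ∸ m)))
    ≡ ⟦ n ! ⟧ * ((log1p ^ₛ m) ⊛ Y) n
S₁-convolution {m} {n} Y m≤n = begin
  sumTo (n ∸ m) (λ l → ⟦ m ! ⟧ * ⟦ n C (l +ℕ m) ⟧ * S₁ (l +ℕ m) m * (⟦ (n ∸ l ∸ m) ! ⟧ * Y (n ∸ l ∸ m)))
    ≡⟨ sumTo-cong-≤ (n ∸ m) (λ l l≤n∸m →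
         trans (cong (λ r → ⟦ m ! ⟧ * ⟦ n C (l +ℕ m) ⟧ * S₁ (l +ℕ m) m * (⟦ r ! ⟧ * Y r)) (ℕP.∸-+-assoc n l m))
               (term (l +ℕ m) (ℕP.m≤o∸n⇒m+n≤o l m≤n l≤n∸m))) ⟩
  sumTo (n ∸ m) (λ l → ⟦ n ! ⟧ * W (l +ℕ m))   ≡⟨ sumTo-*ˡ (n ∸ m) ⟦ n ! ⟧ (λ l → W (l +ℕ m)) ⟩
  ⟦ n ! ⟧ * sumTo (n ∸ m) (λ l → W (l +ℕ m))   ≡⟨ cong (⟦ n ! ⟧ *_) (sumTo-drop-prefix W m≤n low-terms) ⟨
  ⟦ n ! ⟧ * sumTo n W                          ∎
  where
  open ≡-Reasoning
  W : ℕ → ℚ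
  W i = (log1p ^ₛ m) i * Y (n ∸ i)
  low-terms : ∀ i → i < m → W i ≡ 0ℚ
  low-terms i i<m = trans (cong (_* Y (n ∸ i)) (^ₛ-vanishes log1p refl m i i<m)) (ℚP.*-zeroˡ (Y (n ∸ i)))
  term : ∀ j → j ≤ n → ⟦ m ! ⟧ * ⟦ n C j ⟧ * S₁ j m * (⟦ (n ∸ j) ! ⟧ * Y (n ∸ j)) ≡ ⟦ n ! ⟧ * W j
  term j j≤n = begin
    ⟦ m ! ⟧ * ⟦ n C j ⟧ * (⟦ j ! ⟧ * invFact m * (log1p ^ₛ m) j) * (⟦ (n ∸ j) ! ⟧ * Y (n ∸ j))
      ≡⟨ solve 7 (λ a b c e f x y → a :* b :* (c :* e :* x) :* (f :* y) := (a :* e) :* (b :* c :* f :* (x :* y)))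
               refl ⟦ m ! ⟧ ⟦ n C j ⟧ ⟦ j ! ⟧ (invFact m) ⟦ (n ∸ j) ! ⟧ ((log1p ^ₛ m) j) (Y (n ∸ j)) ⟩
    (⟦ m ! ⟧ * invFact m) * (⟦ n C j ⟧ * ⟦ j ! ⟧ * ⟦ (n ∸ j) ! ⟧ * W j)
      ≡⟨ cong₂ (λ u v → u * (v * W j)) (⟦!⟧*invFact m) (⟦C⟧*⟦!⟧*⟦!⟧ j≤n) ⟩
    1ℚ * (⟦ n ! ⟧ * W j)
      ≡⟨ ℚP.*-identityˡ (⟦ n ! ⟧ * W j) ⟩
    ⟦ n ! ⟧ * W j ∎

theorem5 : (k : ℤ) (n m : ℕ) → 1 ≤ m → m ≤ n →
    sumTo (n ∸ m) (λ l → ⟦ m ! ⟧ * ⟦ n C (l +ℕ m) ⟧ * S₁ (l +ℕ m) m * polyCauchy₀ (n ∸ l ∸ m) k)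
      ≡ sumTo (n ∸ m) (λ l → ⟦ (m ∸ 1) ! ⟧ * ⟦ (n ∸ 1) C (l +ℕ m ∸ 1) ⟧ * S₁ (l +ℕ m ∸ 1) (m ∸ 1)
          * (⟦ m ∸ 1 ⟧ * polyCauchy (n ∸ l ∸ m) k 1ℚ + polyCauchy (n ∸ l ∸ m) (k - ι 1) 1ℚ))
theorem5 k (suc n) (suc p) _ (s≤s p≤n) = begin
  _  ≡⟨ sumTo-cong (n ∸ p) (λ l → cong (⟦ suc p ! ⟧ * ⟦ suc n C (l +ℕ suc p) ⟧ * S₁ (l +ℕ suc p) (suc p) *_)
                                       (polyCauchy₀≡⟦!⟧*lifLog (suc n ∸ l ∸ suc p) k)) ⟩
  _  ≡⟨ S₁-convolution (lifLog k) (s≤s p≤n) ⟩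
  ⟦ suc n ! ⟧ * ((log1p ^ₛ suc p) ⊛ lifLog k) (suc n)  ≡⟨ ⟦suc!⟧*≡⟦!⟧*D n ((log1p ^ₛ suc p) ⊛ lifLog k) ⟩
  ⟦ n ! ⟧ * D ((log1p ^ₛ suc p) ⊛ lifLog k) n          ≡⟨ cong (⟦ n ! ⟧ *_) (D-log1p^⊛lifLog k p n) ⟩
  ⟦ n ! ⟧ * ((log1p ^ₛ p) ⊛ Q) n                       ≡⟨ S₁-convolution Q p≤n ⟨
  _  ≡⟨ sumTo-cong (n ∸ p) (λ l → trans
          (cong (⟦ p ! ⟧ * ⟦ n C (l +ℕ p) ⟧ * S₁ (l +ℕ p) p *_) (polyCauchy₁-combination k p (n ∸ l ∸ p)))
          (cong₂ (λ j r → ⟦ p ! ⟧ * ⟦ n C j ⟧ * S₁ j p * (⟦ p ⟧ * polyCauchy r k 1ℚ + polyCauchy r (k - ι 1) 1ℚ))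
                 (cong (_∸ 1) (sym (ℕP.+-suc l p))) (sym (suc-∸-∸-suc n l p)))) ⟩
  _  ∎
  where
  open ≡-Reasoning
  Q : FPS
  Q = ⟦ p ⟧ · (lifLog k ⊛ 1/[1+t]) ⊕ lifLog (k - ι 1) ⊛ 1/[1+t]
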